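{- Let $n,m\in\mathbb{N}$. The following conditions are equivalent: (i) $n$ is $D(m)$-practical; (ii) $m$ is $D(n)$-practical; (iii) $\gcd(n,m)$ is a practical number.
   Context: For $n\in\mathbb{N}$, $D(n)$ is the set of positive divisors of $n$. For $A\subset\mathbb{N}$, $S_A=\sum_{a\in A}a$ ($S_\emptyset=0$), and $A$ is called a practical set if every non-negative integer $k\le S_A$ is a sum of distinct elements of $A$. For $A\subset\mathbb{N}$, a number $n\in\mathbb{N}$ is $A$-practical if $D(n)\cap A$ is a practical set. A positive integer $n$ is a practical number if $D(n)$ is a practical set (equivalently, every integer between $1$ and $\sigma(n)$ is a sum of distinct divisors of $n$). -}

module Defs where

open import Data.Nat using (ℕ; zero; suc; _≤_; NonZero)
open import Data.Nat.Divisibility using (_∣_; _∣?_)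
open import Data.List using (List; filter; upTo; map)
open import Data.Nat.ListAction using (sum)
open import Data.List.Relation.Binary.Sublist.Propositional using (_⊆_)
open import Data.Product using (Σ; _×_)
open import Relation.Binary.PropositionalEquality using (_≡_)

D : ℕ → List ℕ
D n = filter (_∣? n) (map suc (upTo n))

-- A finite set of naturals, represented as a duplicate-free list, is
-- practical if every k ≤ S_A is a sum of distinct elements of A,
-- i.e. the sum of a sub-list (sub-lists of a duplicate-free list are
-- exactly the subsets).
IsPracticalSet : List ℕ → Set
IsPracticalSet A = ∀ k → k ≤ sum A → Σ (List ℕ) λ B → B ⊆ A × sum B ≡ k

-- D(n) ∩ A, where A is given by a decidable membership test (here A = D m)
-- n is D(m)-practical : D(n) ∩ D(m) is a practical set.
DivPractical : ℕ → ℕ → Set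
DivPractical m n = IsPracticalSet (filter (_∣? m) (D n))

Practical : ℕ → Set
Practical n = IsPracticalSet (D n)

-- A natural number divides both n and m exactly when it divides gcd n m,
-- and for n, m ≥ 1 every divisor of gcd n m already lies in 1..n, so the
-- list D n filtered by divisibility by m is literally the list D (gcd n m).
module Submission where

open import Defs
open import Data.Nat using (ℕ; NonZero; zero; suc; _≤_; s≤s; ≢-nonZero; ≢-nonZero⁻¹)
open import Data.Nat.Properties using (m≤n⇒m<n∨m≡n; n≤0⇒n≡0)
open import Data.Nat.Divisibility using (_∣_; _∣?_; ∣-trans; >⇒∤)
open import Data.Nat.GCD using (gcd; gcd[m,n]∣m; gcd[m,n]∣n; gcd-greatest; gcd-comm; gcd[m,n]≤n; gcd[m,n]≢0)
open import Data.List using (List; []; _∷_; _++_; _∷ʳ_; filter; map; upTo)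
open import Data.List.Properties using (filter-++; filter-reject; filter-≐; map-++; upTo-∷ʳ; ++-identityʳ)
open import Data.Product using (_×_; _,_)
open import Data.Sum using (inj₁; inj₂)
open import Function.Bundles using (_⇔_)
open import Function.Properties.Equivalence using (⇔-isEquivalence)
open import Relation.Binary.Structures using (IsEquivalence)
open import Relation.Nullary using (yes; no; ¬_)
open import Relation.Nullary.Negation using (contradiction)
open import Relation.Unary using (Pred; Decidable; _∩_; _≐_)
open import Relation.Unary.Properties using (_∩?_)
open import Relation.Binary.PropositionalEquality using (_≡_; refl; sym; trans; cong; subst; module ≡-Reasoning)

filter-filter : ∀ {a p q} {A : Set a} {P : Pred A p} {Q : Pred A q}
  (P? : Decidable P) (Q? : Decidable Q) (xs : List A) →
  filter Q? (filter P? xs) ≡ filter (P? ∩? Q?) xs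
filter-filter P? Q? [] = refl
filter-filter P? Q? (x ∷ xs) with P? x
... | no _ = filter-filter P? Q? xs
... | yes _ with Q? x
...   | yes _ = cong (x ∷_) (filter-filter P? Q? xs)
...   | no _ = filter-filter P? Q? xs

∣×∣⇔∣gcd : ∀ n m → (_∣ n) ∩ (_∣ m) ≐ (_∣ gcd n m)
∣×∣⇔∣gcd n m = (λ (d∣n , d∣m) → gcd-greatest d∣n d∣m)
             , (λ d∣g → ∣-trans d∣g (gcd[m,n]∣m n m) , ∣-trans d∣g (gcd[m,n]∣n n m))

filter-upTo-suc-reject : ∀ {p} {P : Pred ℕ p} (P? : Decidable P) N → ¬ P (suc N) →
  filter P? (map suc (upTo (suc N))) ≡ filter P? (map suc (upTo N))
filter-upTo-suc-reject P? N ¬P[1+N] = begin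
  filter P? (map suc (upTo (suc N)))              ≡⟨ cong (λ l → filter P? (map suc l)) (sym (upTo-∷ʳ N)) ⟩
  filter P? (map suc (upTo N ∷ʳ N))               ≡⟨ cong (filter P?) (map-++ suc (upTo N) (N ∷ [])) ⟩
  filter P? (map suc (upTo N) ++ suc N ∷ [])      ≡⟨ filter-++ P? (map suc (upTo N)) (suc N ∷ []) ⟩
  filter P? (map suc (upTo N)) ++ filter P? (suc N ∷ [])
    ≡⟨ cong (filter P? (map suc (upTo N)) ++_) (filter-reject P? {xs = []} ¬P[1+N]) ⟩
  filter P? (map suc (upTo N)) ++ []              ≡⟨ ++-identityʳ _ ⟩
  filter P? (map suc (upTo N))                    ∎
  where open ≡-Reasoning

filter-∣?-upTo : ∀ g N → .{{NonZero g}} → g ≤ N →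
  filter (_∣? g) (map suc (upTo N)) ≡ D g
filter-∣?-upTo g zero g≤0 = contradiction (n≤0⇒n≡0 g≤0) (≢-nonZero⁻¹ g)
filter-∣?-upTo g (suc N) g≤1+N with m≤n⇒m<n∨m≡n g≤1+N
... | inj₁ (s≤s g≤N) = trans (filter-upTo-suc-reject (_∣? g) N (>⇒∤ (s≤s g≤N))) (filter-∣?-upTo g N g≤N)
... | inj₂ refl = refl

filter-∣?-D : ∀ n m → .{{NonZero n}} → .{{NonZero m}} →
  filter (_∣? m) (D n) ≡ D (gcd n m)
filter-∣?-D n m = begin
  filter (_∣? m) (filter (_∣? n) (map suc (upTo n)))  ≡⟨ filter-filter (_∣? n) (_∣? m) (map suc (upTo n)) ⟩
  filter ((_∣? n) ∩? (_∣? m)) (map suc (upTo n))      ≡⟨ filter-≐ ((_∣? n) ∩? (_∣? m)) (_∣? gcd n m) (∣×∣⇔∣gcd n m) (map suc (upTo n)) ⟩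
  filter (_∣? gcd n m) (map suc (upTo n))             ≡⟨ filter-∣?-upTo (gcd n m) n gcd≤n ⟩
  D (gcd n m)                                         ∎
  where
  open ≡-Reasoning
  instance
    gcd≢0 : NonZero (gcd n m)
    gcd≢0 = ≢-nonZero (gcd[m,n]≢0 n m (inj₁ (≢-nonZero⁻¹ n)))
  gcd≤n : gcd n m ≤ n
  gcd≤n = subst (_≤ n) (gcd-comm m n) (gcd[m,n]≤n m n)

DivPractical≡Practical-gcd : ∀ m n → .{{NonZero m}} → .{{NonZero n}} →
  DivPractical m n ≡ Practical (gcd n m)
DivPractical≡Practical-gcd m n = cong IsPracticalSet (filter-∣?-D n m)

theorem3p3 : (n m : ℕ) → .{{NonZero n}} → .{{NonZero m}} →
    (DivPractical m n ⇔ DivPractical n m)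
      × (DivPractical n m ⇔ Practical (gcd n m))
theorem3p3 n m = ≡⇒⇔ (trans n-side (sym m-side)) , ≡⇒⇔ m-side
  where
  ≡⇒⇔ : ∀ {A B : Set} → A ≡ B → A ⇔ B
  ≡⇒⇔ = IsEquivalence.reflexive ⇔-isEquivalence
  n-side : DivPractical m n ≡ Practical (gcd n m)
  n-side = DivPractical≡Practical-gcd m n
  m-side : DivPractical n m ≡ Practical (gcd n m)
  m-side = trans (DivPractical≡Practical-gcd n m) (cong Practical (gcd-comm m n))
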